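{- Let $\mathbf{a}=(a_1,a_2,\ldots)$ and $\mathbf{e}=(e_1,e_2,\ldots)$ be arbitrary real sequences (both infinite, or both of the same finite length $n$). Then for all $m\ge k\ge 0$ (with $m\le n$ in the finite case) $$S^{\mathbf{a},\mathbf{e}}(m,k)=\sum_{\substack{S=\{s_1,\ldots,s_{m-k}\}\subseteq\{1,\ldots,m\}\\ s_1<\cdots<s_{m-k}}}\prod_{i=1}^{m-k}\left(a_{s_i-i+1}-e_{s_i}\right),$$ and, equivalently, writing $s^{\mathbf{a},\mathbf{e}}(m,k)$ for the $(m,k)$ entry of $(S^{\mathbf{a},\mathbf{e}})^{ -1}$, $$(-1)^{m-k}s^{\mathbf{a},\mathbf{e}}(m,k)=\sum_{\substack{S=\{s_1,\ldots,s_{m-k}\}\subseteq\{1,\ldots,m\}\\ s_1<\cdots<s_{m-k}}}\prod_{i=1}^{m-k}\left(a_{s_i}-e_{s_i-i+1}\right).$$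
   Context: The matrix $S^{\mathbf{a},\mathbf{e}}=[S^{\mathbf{a},\mathbf{e}}(m,k)]_{m,k\ge0}$ is defined by the unique expansions $\prod_{i=1}^m(x-e_i)=\sum_{k=0}^m S^{\mathbf{a},\mathbf{e}}(m,k)\prod_{i=1}^k(x-a_i)$ for $m\ge0$, with $S^{\mathbf{a},\mathbf{e}}(m,k)=0$ for $k>m$. It is lower triangular with ones on the diagonal, so invertible. An empty product equals $1$. -}

module Defs where

open import Level using (Level)
open import Algebra.Bundles using (CommutativeRing)
open import Data.Nat using (ℕ; zero; suc; _∸_; _<_; _≟_)
open import Data.List using (List; []; _∷_; map; _++_; foldr; upTo)
open import Relation.Nullary using (yes; no)
open import Data.Product using (_×_)

module _ {c ℓ : Level} (R : CommutativeRing c ℓ) where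
  open CommutativeRing R hiding (zero)

  -- Polynomials over R, represented by their coefficient function
  -- (coefficient of x^d at d).  All polynomials below are finitely supported.
  Poly : Set c
  Poly = ℕ → Carrier

  -- p ↦ p · (x - c)
  mulLin : Carrier → Poly → Poly
  mulLin a p zero    = - (a * p zero)
  mulLin a p (suc d) = p d - a * p (suc d)

  onePoly : Poly
  onePoly zero    = 1#
  onePoly (suc d) = 0#

  -- ∏_{i=1}^{k} (x - a_i)   (sequences are 1-indexed; index 0 unused)
  prodLin : (ℕ → Carrier) → ℕ → Poly
  prodLin a zero    = onePoly
  prodLin a (suc k) = mulLin (a (suc k)) (prodLin a k)

  sumBelow : ℕ → (ℕ → Carrier) → Carrier
  sumBelow zero    f = 0#
  sumBelow (suc n) f = sumBelow n f + f n

  sumList : List Carrier → Carrier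
  sumList = foldr _+_ 0#

  δ : ℕ → ℕ → Carrier
  δ m k with m ≟ k
  ... | yes _ = 1#
  ... | no  _ = 0#

  negOnePow : ℕ → Carrier
  negOnePow zero    = 1#
  negOnePow (suc r) = (- 1#) * negOnePow r

  IsConnectionMatrix : (a e : ℕ → Carrier) → (ℕ → ℕ → Carrier) → Set ℓ
  IsConnectionMatrix a e S =
    (∀ m k → m < k → S m k ≈ 0#) ×
    (∀ m d → prodLin e m d ≈ sumBelow (suc m) (λ k → S m k * prodLin a k d))

  -- s is the (two-sided) inverse of the lower triangular matrix S;
  -- s is lower triangular so all matrix products are finite sums.
  IsInverseOf : (ℕ → ℕ → Carrier) → (ℕ → ℕ → Carrier) → Set ℓ
  IsInverseOf S s =
    (∀ m k → m < k → s m k ≈ 0#) ×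
    ((∀ m k → sumBelow (suc m) (λ j → S m j * s j k) ≈ δ m k) ×
     (∀ m k → sumBelow (suc m) (λ j → s m j * S j k) ≈ δ m k))

-- r-element subsets of a list, as ordered sublists (increasing if the list is).
choose : ℕ → List ℕ → List (List ℕ)
choose zero    _        = [] ∷ []
choose (suc r) []       = []
choose (suc r) (x ∷ xs) = map (x ∷_) (choose r xs) ++ choose (suc r) xs

oneTo : ℕ → List ℕ
oneTo m = map suc (upTo m)

module _ {c ℓ : Level} (R : CommutativeRing c ℓ) where
  open CommutativeRing R hiding (zero)

  prodIdx : (ℕ → ℕ → Carrier) → ℕ → List ℕ → Carrier
  prodIdx f i []       = 1#
  prodIdx f i (s ∷ ss) = f s i * prodIdx f (suc i) ss

  formulaS : (a e : ℕ → Carrier) → ℕ → ℕ → Carrier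
  formulaS a e m k =
    sumList R (map (prodIdx (λ s i → a (suc s ∸ i) - e s) 1) (choose (m ∸ k) (oneTo m)))

  formulas : (a e : ℕ → Carrier) → ℕ → ℕ → Carrier
  formulas a e m k =
    sumList R (map (prodIdx (λ s i → a s - e (suc s ∸ i)) 1) (choose (m ∸ k) (oneTo m)))

module Submission where

-- Multiplying ∏_{i≤m}(x - e_i) = Σ_k S(m,k) P_k, where P_k = ∏_{i≤k}(x - a_i),
-- by (x - e_{m+1}) and using  (x - c) P_k = P_{k+1} + (a_{k+1} - c) P_k
-- gives, by uniqueness of coordinates in the basis (P_k), the recurrence
--   S(m+1,k) = S(m,k-1) + (a_{k+1} - e_{m+1}) S(m,k),     S(m,m) = 1.
-- On the other side, splitting the r-subsets of {1..m+1} according to whether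
-- they contain m+1 shows that the subset sum  Σ_S ∏_i (a_{s_i-i+1} - e_{s_i})
-- satisfies the same recurrence, so the two agree by induction on m.
-- The inverse s of S is the connection matrix with the roles of a and e
-- swapped; hence s(m,k) is given by the same formula with a and e exchanged,
-- and multiplying each of its m-k factors by -1 yields the second identity.

open import Level using (Level)
open import Algebra.Bundles using (CommutativeRing)
open import Data.Nat using (ℕ; zero; suc; _≤_; _<_; _∸_; z≤n; s≤s; _≟_)
  renaming (_+_ to _+ℕ_)
open import Data.Nat.Properties
  using ( ≤-pred; ≤-reflexive; <⇒≤; <⇒≢; n<1+n; m≤n⇒m≤1+n; m<n⇒m<1+n
        ; m≤n⇒m<n∨m≡n; m<1+n⇒m<n∨m≡n; +-∸-assoc; m∸n≤m; m∸[m∸n]≡n; n∸n≡0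
        ; n≤1+n)
  renaming (+-suc to ℕ-+-suc; +-identityʳ to ℕ-+-identityʳ)
open import Data.Product using (_×_; _,_; proj₁; proj₂)
open import Data.Sum using (_⊎_; inj₁; inj₂)
open import Data.Empty using (⊥-elim)
open import Data.List using (List; []; _∷_; map; _++_; length; upTo)
open import Data.List.Properties using (map-++; upTo-∷ʳ; length-map; length-upTo)
open import Relation.Nullary using (yes; no)
open import Relation.Binary.PropositionalEquality as ≡ using (_≡_)
open import Defs

choose-tooMany : ∀ n (xs : List ℕ) → length xs ≤ n → choose (suc n) xs ≡ []
choose-tooMany n       []       _         = ≡.refl
choose-tooMany (suc n) (x ∷ xs) (s≤s len)
  rewrite choose-tooMany n xs len | choose-tooMany (suc n) xs (m≤n⇒m≤1+n len) = ≡.refl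

length-oneTo : ∀ m → length (oneTo m) ≡ m
length-oneTo m = ≡.trans (length-map suc (upTo m)) (length-upTo m)

oneTo-snoc : ∀ m → oneTo (suc m) ≡ oneTo m ++ suc m ∷ []
oneTo-snoc m = ≡.trans (≡.cong (map suc) (≡.sym (upTo-∷ʳ m))) (map-++ suc (upTo m) (m ∷ []))

suc-∸-complement : ∀ m k → k ≤ m → suc m ∸ (m ∸ k) ≡ suc k
suc-∸-complement m k k≤m = ≡.trans (+-∸-assoc 1 (m∸n≤m m k)) (≡.cong suc (m∸[m∸n]≡n k≤m))

module ConnectionCoefficients {c ℓ : Level} (R : CommutativeRing c ℓ) where
  open CommutativeRing R hiding (zero)
  open import Relation.Binary.Reasoning.Setoid setoid
  open import Algebra.Properties.Ring ring using (-‿distribˡ-*; -‿distribʳ-*; -1*x≈-x)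
  open import Algebra.Properties.AbelianGroup +-abelianGroup using (⁻¹-∙-comm; ⁻¹-anti-homo‿-)
  open import Algebra.Properties.Group +-group using (∙-cancelʳ; ε⁻¹≈ε)
  open import Algebra.Properties.CommutativeSemigroup +-commutativeSemigroup
    using () renaming (interchange to +-interchange)
  open import Algebra.Properties.CommutativeSemigroup *-commutativeSemigroup
    using (x∙yz≈y∙xz; x∙yz≈yx∙z) renaming (interchange to *-interchange)

  Σ : ℕ → (ℕ → Carrier) → Carrier
  Σ = sumBelow R

  Σ-cong : ∀ n {f g : ℕ → Carrier} → (∀ k → k < n → f k ≈ g k) → Σ n f ≈ Σ n g
  Σ-cong zero    f≈g = refl
  Σ-cong (suc n) f≈g = +-cong (Σ-cong n (λ k k<n → f≈g k (m<n⇒m<1+n k<n))) (f≈g n (n<1+n n))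

  Σ-0# : ∀ n → Σ n (λ _ → 0#) ≈ 0#
  Σ-0# zero    = refl
  Σ-0# (suc n) = trans (+-identityʳ _) (Σ-0# n)

  Σ-vanishing : ∀ n (f : ℕ → Carrier) → (∀ k → k < n → f k ≈ 0#) → Σ n f ≈ 0#
  Σ-vanishing n f f≈0 = trans (Σ-cong n f≈0) (Σ-0# n)

  Σ-+ : ∀ n (f g : ℕ → Carrier) → Σ n (λ k → f k + g k) ≈ Σ n f + Σ n g
  Σ-+ zero    f g = sym (+-identityʳ 0#)
  Σ-+ (suc n) f g = trans (+-congʳ (Σ-+ n f g)) (+-interchange _ _ _ _)

  Σ-*ˡ : ∀ n x (f : ℕ → Carrier) → x * Σ n f ≈ Σ n (λ k → x * f k)
  Σ-*ˡ zero    x f = zeroʳ x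
  Σ-*ˡ (suc n) x f = trans (distribˡ x _ _) (+-congʳ (Σ-*ˡ n x f))

  Σ-*ʳ : ∀ n x (f : ℕ → Carrier) → Σ n f * x ≈ Σ n (λ k → f k * x)
  Σ-*ʳ zero    x f = zeroˡ x
  Σ-*ʳ (suc n) x f = trans (distribʳ x _ _) (+-congʳ (Σ-*ʳ n x f))

  Σ-swap : ∀ n p (f : ℕ → ℕ → Carrier) →
    Σ n (λ j → Σ p (λ k → f j k)) ≈ Σ p (λ k → Σ n (λ j → f j k))
  Σ-swap zero    p f = sym (Σ-0# p)
  Σ-swap (suc n) p f = trans (+-congʳ (Σ-swap n p f)) (sym (Σ-+ p _ _))

  Σ-shift : ∀ n (f : ℕ → Carrier) → Σ (suc n) f ≈ f 0 + Σ n (λ k → f (suc k))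
  Σ-shift zero    f = trans (+-identityˡ _) (sym (+-identityʳ _))
  Σ-shift (suc n) f = trans (+-congʳ (Σ-shift n f)) (+-assoc _ _ _)

  Σ-extend : ∀ j m (f : ℕ → Carrier) → j ≤ m → (∀ k → j < k → f k ≈ 0#) →
    Σ (suc j) f ≈ Σ (suc m) f
  Σ-extend j zero    f z≤n f≈0 = refl
  Σ-extend j (suc m) f j≤   f≈0 with m≤n⇒m<n∨m≡n j≤
  ... | inj₂ ≡.refl     = refl
  ... | inj₁ (s≤s j≤m) =
    trans (Σ-extend j m f j≤m f≈0) (trans (sym (+-identityʳ _)) (+-congˡ (sym (f≈0 (suc m) (s≤s j≤m)))))

  below : (ℕ → Carrier) → ℕ → Carrier
  below f zero    = 0#
  below f (suc k) = f k

  Σ-below : ∀ n (f g : ℕ → Carrier) → Σ (suc n) (λ k → below f k * g k) ≈ Σ n (λ k → f k * g (suc k))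
  Σ-below n f g = trans (Σ-shift n _) (trans (+-congʳ (zeroˡ (g 0))) (+-identityˡ _))

  Σ-δ : ∀ m (g : ℕ → Carrier) → Σ (suc m) (λ k → δ R m k * g k) ≈ g m
  Σ-δ m g = begin
    Σ m (λ k → δ R m k * g k) + δ R m m * g m
      ≈⟨ +-cong (Σ-vanishing m _ (λ k k<m → trans (*-congʳ (δ-off k<m)) (zeroˡ _)))
                (trans (*-congʳ δ-diag) (*-identityˡ _)) ⟩
    0# + g m ≈⟨ +-identityˡ _ ⟩
    g m      ∎
    where
    δ-diag : δ R m m ≈ 1#
    δ-diag with m ≟ m
    ... | yes _  = refl
    ... | no m≢m = ⊥-elim (m≢m ≡.refl)
    δ-off : ∀ {k} → k < m → δ R m k ≈ 0#
    δ-off {k} k<m with m ≟ k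
    ... | yes m≡k = ⊥-elim (<⇒≢ k<m (≡.sym m≡k))
    ... | no _    = refl

  mulLin-cong : ∀ c₀ (p q : Poly R) → (∀ d → p d ≈ q d) → ∀ d → mulLin R c₀ p d ≈ mulLin R c₀ q d
  mulLin-cong c₀ p q p≈q zero    = -‿cong (*-congˡ (p≈q 0))
  mulLin-cong c₀ p q p≈q (suc d) = +-cong (p≈q d) (-‿cong (*-congˡ (p≈q (suc d))))

  mulLin-0 : ∀ c₀ d → mulLin R c₀ (λ _ → 0#) d ≈ 0#
  mulLin-0 c₀ zero    = trans (-‿cong (zeroʳ c₀)) ε⁻¹≈ε
  mulLin-0 c₀ (suc d) = trans (+-identityˡ _) (trans (-‿cong (zeroʳ c₀)) ε⁻¹≈ε)

  mulLin-+ : ∀ c₀ (p q : Poly R) d →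
    mulLin R c₀ (λ d → p d + q d) d ≈ mulLin R c₀ p d + mulLin R c₀ q d
  mulLin-+ c₀ p q zero    = trans (-‿cong (distribˡ c₀ _ _)) (sym (⁻¹-∙-comm _ _))
  mulLin-+ c₀ p q (suc d) =
    trans (+-congˡ (trans (-‿cong (distribˡ c₀ _ _)) (sym (⁻¹-∙-comm _ _)))) (+-interchange _ _ _ _)

  mulLin-* : ∀ c₀ x (p : Poly R) d → mulLin R c₀ (λ d → x * p d) d ≈ x * mulLin R c₀ p d
  mulLin-* c₀ x p zero    = trans (-‿cong (x∙yz≈y∙xz c₀ x _)) (-‿distribʳ-* x _)
  mulLin-* c₀ x p (suc d) =
    trans (+-congˡ (trans (-‿cong (x∙yz≈y∙xz c₀ x _)) (-‿distribʳ-* x _))) (sym (distribˡ x _ _))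

  mulLin-Σ : ∀ c₀ n (α : ℕ → Carrier) (p : ℕ → Poly R) d →
    mulLin R c₀ (λ d → Σ n (λ k → α k * p k d)) d ≈ Σ n (λ k → α k * mulLin R c₀ (p k) d)
  mulLin-Σ c₀ zero    α p d = mulLin-0 c₀ d
  mulLin-Σ c₀ (suc n) α p d =
    trans (mulLin-+ c₀ _ _ d) (+-cong (mulLin-Σ c₀ n α p d) (mulLin-* c₀ (α n) (p n) d))

  neg-rebase : ∀ b c₀ y → - (c₀ * y) ≈ - (b * y) + (b - c₀) * y
  neg-rebase b c₀ y = sym (begin
    - (b * y) + (b - c₀) * y
      ≈⟨ +-congˡ (trans (distribʳ y b (- c₀)) (+-congˡ (sym (-‿distribˡ-* c₀ y)))) ⟩
    - (b * y) + (b * y + - (c₀ * y)) ≈⟨ sym (+-assoc _ _ _) ⟩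
    (- (b * y) + b * y) + - (c₀ * y) ≈⟨ +-congʳ (-‿inverseˡ _) ⟩
    0# + - (c₀ * y)                  ≈⟨ +-identityˡ _ ⟩
    - (c₀ * y)                       ∎)

  mulLin-rebase : ∀ b c₀ (p : Poly R) d → mulLin R c₀ p d ≈ mulLin R b p d + (b - c₀) * p d
  mulLin-rebase b c₀ p zero    = neg-rebase b c₀ (p 0)
  mulLin-rebase b c₀ p (suc d) = trans (+-congˡ (neg-rebase b c₀ (p (suc d)))) (sym (+-assoc _ _ _))

  -- The basis P_k = ∏_{i≤k} (x - a_i): monic of degree k, so coordinates
  -- with respect to it are unique.

  module Basis (a : ℕ → Carrier) where
    P : ℕ → Poly R
    P = prodLin R a

    prodLin-above-degree : ∀ k d → k < d → P k d ≈ 0#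
    prodLin-above-degree zero    (suc d) _         = refl
    prodLin-above-degree (suc k) (suc d) (s≤s k<d) = trans
      (+-cong (prodLin-above-degree k d k<d)
              (-‿cong (trans (*-congˡ (prodLin-above-degree k (suc d) (m<n⇒m<1+n k<d))) (zeroʳ _))))
      (trans (+-identityˡ _) ε⁻¹≈ε)

    prodLin-monic : ∀ k → P k k ≈ 1#
    prodLin-monic zero    = refl
    prodLin-monic (suc k) = trans
      (+-cong (prodLin-monic k) (-‿cong (trans (*-congˡ (prodLin-above-degree k (suc k) (n<1+n k))) (zeroʳ _))))
      (trans (+-congˡ ε⁻¹≈ε) (+-identityʳ _))

    mulLin-prodLin : ∀ c₀ k d → mulLin R c₀ (P k) d ≈ P (suc k) d + (a (suc k) - c₀) * P k d
    mulLin-prodLin c₀ k = mulLin-rebase (a (suc k)) c₀ (P k)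

    leading-coordinate : ∀ n (x : ℕ → Carrier) → Σ (suc n) (λ k → x k * P k n) ≈ x n
    leading-coordinate n x = trans
      (+-cong (Σ-vanishing n _ (λ k k<n → trans (*-congˡ (prodLin-above-degree k n k<n)) (zeroʳ _)))
              (trans (*-congˡ (prodLin-monic n)) (*-identityʳ _)))
      (+-identityˡ _)

    coordinates-unique : ∀ n (x y : ℕ → Carrier) →
      (∀ d → Σ n (λ k → x k * P k d) ≈ Σ n (λ k → y k * P k d)) → ∀ k → k < n → x k ≈ y k
    coordinates-unique (suc n) x y same k k<1+n = by-position (m<1+n⇒m<n∨m≡n k<1+n)
      where
      top : x n ≈ y n
      top = trans (sym (leading-coordinate n x)) (trans (same n) (leading-coordinate n y))
      same′ : ∀ d → Σ n (λ k → x k * P k d) ≈ Σ n (λ k → y k * P k d)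
      same′ d = ∙-cancelʳ (x n * P n d) _ _ (trans (same d) (+-congˡ (*-congʳ (sym top))))
      by-position : k < n ⊎ k ≡ n → x k ≈ y k
      by-position (inj₁ k<n)   = coordinates-unique n x y same′ k k<n
      by-position (inj₂ ≡.refl) = top

  module Connection (a e : ℕ → Carrier) (S : ℕ → ℕ → Carrier) (conn : IsConnectionMatrix R a e S) where
    open Basis a
    open Basis e using () renaming (P to Q; prodLin-monic to Q-monic)

    lower-triangular : ∀ m k → m < k → S m k ≈ 0#
    lower-triangular = proj₁ conn

    expansion : ∀ m d → Q m d ≈ Σ (suc m) (λ k → S m k * P k d)
    expansion = proj₂ conn

    diagonal : ∀ m → S m m ≈ 1#
    diagonal m = trans (sym (leading-coordinate m (S m))) (trans (sym (expansion m m)) (Q-monic m))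

    recurrence : ∀ m k → k ≤ suc m → S (suc m) k ≈ below (S m) k + (a (suc k) - e (suc m)) * S m k
    recurrence m k k≤ = coordinates-unique (suc (suc m)) (S (suc m)) T both-expand k (s≤s k≤)
      where
      γ : ℕ → Carrier
      γ k = a (suc k) - e (suc m)
      T : ℕ → Carrier
      T k = below (S m) k + γ k * S m k
      both-expand : ∀ d → Σ (suc (suc m)) (λ k → S (suc m) k * P k d) ≈ Σ (suc (suc m)) (λ k → T k * P k d)
      both-expand d = begin
        Σ (suc (suc m)) (λ k → S (suc m) k * P k d) ≈⟨ sym (expansion (suc m) d) ⟩
        mulLin R (e (suc m)) (Q m) d ≈⟨ mulLin-cong (e (suc m)) _ _ (expansion m) d ⟩
        mulLin R (e (suc m)) (λ d → Σ (suc m) (λ k → S m k * P k d)) d ≈⟨ mulLin-Σ (e (suc m)) (suc m) (S m) P d ⟩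
        Σ (suc m) (λ k → S m k * mulLin R (e (suc m)) (P k) d)
          ≈⟨ Σ-cong (suc m) (λ k _ → trans (*-congˡ (mulLin-prodLin (e (suc m)) k d))
                                           (trans (distribˡ _ _ _) (+-congˡ (x∙yz≈yx∙z _ _ _)))) ⟩
        Σ (suc m) (λ k → S m k * P (suc k) d + (γ k * S m k) * P k d) ≈⟨ Σ-+ (suc m) _ _ ⟩
        Σ (suc m) (λ k → S m k * P (suc k) d) + Σ (suc m) (λ k → (γ k * S m k) * P k d)
          ≈⟨ +-cong (sym (Σ-below (suc m) (S m) (λ k → P k d)))
                    (Σ-extend m (suc m) _ (n≤1+n m)
                       (λ k m<k → trans (*-congʳ (trans (*-congˡ (lower-triangular m k m<k)) (zeroʳ _))) (zeroˡ _))) ⟩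
        Σ (suc (suc m)) (λ k → below (S m) k * P k d) + Σ (suc (suc m)) (λ k → (γ k * S m k) * P k d)
          ≈⟨ sym (Σ-+ (suc (suc m)) _ _) ⟩
        Σ (suc (suc m)) (λ k → below (S m) k * P k d + (γ k * S m k) * P k d)
          ≈⟨ Σ-cong (suc (suc m)) (λ k _ → sym (distribʳ _ _ _)) ⟩
        Σ (suc (suc m)) (λ k → T k * P k d) ∎

  -- The inverse of the connection matrix S^{a,e} is the connection matrix S^{e,a}:
  -- substitute the expansion of each P^e_j into Σ_j s(m,j) P^e_j and use s·S = I.
  inverse-connection : (a e : ℕ → Carrier) (S s : ℕ → ℕ → Carrier) →
    IsConnectionMatrix R a e S → IsInverseOf R S s → IsConnectionMatrix R e a s
  inverse-connection a e S s (S-lower , expansion) (s-lower , _ , s·S≈I) = s-lower , λ m d → sym (reexpand m d)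
    where
    open Basis a using (P)
    open Basis e using () renaming (P to Q)
    reexpand : ∀ m d → Σ (suc m) (λ j → s m j * Q j d) ≈ P m d
    reexpand m d = begin
      Σ (suc m) (λ j → s m j * Q j d)
        ≈⟨ Σ-cong (suc m) (λ j j≤m → *-congˡ (trans (expansion j d)
             (Σ-extend j m _ (≤-pred j≤m) (λ k j<k → trans (*-congʳ (S-lower j k j<k)) (zeroˡ _))))) ⟩
      Σ (suc m) (λ j → s m j * Σ (suc m) (λ k → S j k * P k d))
        ≈⟨ Σ-cong (suc m) (λ j _ → Σ-*ˡ (suc m) (s m j) _) ⟩
      Σ (suc m) (λ j → Σ (suc m) (λ k → s m j * (S j k * P k d))) ≈⟨ Σ-swap (suc m) (suc m) _ ⟩
      Σ (suc m) (λ k → Σ (suc m) (λ j → s m j * (S j k * P k d)))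
        ≈⟨ Σ-cong (suc m) (λ k _ → trans (Σ-cong (suc m) (λ j _ → sym (*-assoc _ _ _))) (sym (Σ-*ʳ (suc m) (P k d) _))) ⟩
      Σ (suc m) (λ k → Σ (suc m) (λ j → s m j * S j k) * P k d)
        ≈⟨ Σ-cong (suc m) (λ k _ → *-congʳ (s·S≈I m k)) ⟩
      Σ (suc m) (λ k → δ R m k * P k d) ≈⟨ Σ-δ m (λ k → P k d) ⟩
      P m d ∎

  sumL : List Carrier → Carrier
  sumL = sumList R

  subsetSum : (ℕ → ℕ → Carrier) → ℕ → ℕ → List ℕ → Carrier
  subsetSum f i r xs = sumL (map (prodIdx R f i) (choose r xs))

  sumL-++ : ∀ xs ys → sumL (xs ++ ys) ≈ sumL xs + sumL ys
  sumL-++ []       ys = sym (+-identityˡ _)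
  sumL-++ (x ∷ xs) ys = trans (+-congˡ (sumL-++ xs ys)) (sym (+-assoc _ _ _))

  sumL-prefix : ∀ f i x (L : List (List ℕ)) →
    sumL (map (prodIdx R f i) (map (x ∷_) L)) ≈ f x i * sumL (map (prodIdx R f (suc i)) L)
  sumL-prefix f i x []      = sym (zeroʳ _)
  sumL-prefix f i x (l ∷ L) = trans (+-congˡ (sumL-prefix f i x L)) (sym (distribˡ _ _ _))

  subsetSum-empty : ∀ f i xs → subsetSum f i 0 xs ≈ 1#
  subsetSum-empty f i xs = +-identityʳ 1#

  subsetSum-tooMany : ∀ f i n xs → length xs ≤ n → subsetSum f i (suc n) xs ≈ 0#
  subsetSum-tooMany f i n xs len = reflexive (≡.cong (λ L → sumL (map (prodIdx R f i) L)) (choose-tooMany n xs len))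

  subsetSum-cons : ∀ f i r x xs →
    subsetSum f i (suc r) (x ∷ xs) ≈ f x i * subsetSum f (suc i) r xs + subsetSum f i (suc r) xs
  subsetSum-cons f i r x xs = begin
    sumL (map (prodIdx R f i) (map (x ∷_) (choose r xs) ++ choose (suc r) xs))
      ≡⟨ ≡.cong sumL (map-++ (prodIdx R f i) (map (x ∷_) (choose r xs)) (choose (suc r) xs)) ⟩
    sumL (map (prodIdx R f i) (map (x ∷_) (choose r xs)) ++ map (prodIdx R f i) (choose (suc r) xs))
      ≈⟨ sumL-++ (map (prodIdx R f i) (map (x ∷_) (choose r xs))) (map (prodIdx R f i) (choose (suc r) xs)) ⟩
    _ ≈⟨ +-congʳ (sumL-prefix f i x (choose r xs)) ⟩
    f x i * subsetSum f (suc i) r xs + subsetSum f i (suc r) xs ∎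

  -- Subsets of xs ++ [y] either avoid y or end with y, in position r+1.
  subsetSum-snoc : ∀ f i r xs y →
    subsetSum f i (suc r) (xs ++ y ∷ []) ≈ subsetSum f i (suc r) xs + subsetSum f i r xs * f y (i +ℕ r)
  subsetSum-snoc f i zero [] y = begin
    f y i * 1# + 0#                ≈⟨ trans (+-identityʳ _) (*-identityʳ _) ⟩
    f y i                          ≡⟨ ≡.cong (f y) (≡.sym (ℕ-+-identityʳ i)) ⟩
    f y (i +ℕ 0)                   ≈⟨ sym (trans (+-identityˡ _) (trans (*-congʳ (subsetSum-empty f i [])) (*-identityˡ _))) ⟩
    0# + (1# + 0#) * f y (i +ℕ 0)  ∎
  subsetSum-snoc f i (suc r) [] y = sym (trans (+-identityˡ _) (zeroˡ _))
  subsetSum-snoc f i zero (x ∷ xs) y = begin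
    subsetSum f i 1 (x ∷ xs ++ y ∷ [])                      ≈⟨ subsetSum-cons f i 0 x (xs ++ y ∷ []) ⟩
    f x i * (1# + 0#) + subsetSum f i 1 (xs ++ y ∷ [])      ≈⟨ +-congˡ (subsetSum-snoc f i 0 xs y) ⟩
    f x i * (1# + 0#) + (subsetSum f i 1 xs + (1# + 0#) * g) ≈⟨ sym (+-assoc _ _ _) ⟩
    (f x i * (1# + 0#) + subsetSum f i 1 xs) + (1# + 0#) * g ≈⟨ +-congʳ (sym (subsetSum-cons f i 0 x xs)) ⟩
    subsetSum f i 1 (x ∷ xs) + (1# + 0#) * g                 ∎
    where g = f y (i +ℕ 0)
  subsetSum-snoc f i (suc r) (x ∷ xs) y = begin
    subsetSum f i (suc (suc r)) (x ∷ xs ++ y ∷ [])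
      ≈⟨ subsetSum-cons f i (suc r) x (xs ++ y ∷ []) ⟩
    fx * subsetSum f (suc i) (suc r) (xs ++ y ∷ []) + subsetSum f i (suc (suc r)) (xs ++ y ∷ [])
      ≈⟨ +-cong (*-congˡ (subsetSum-snoc f (suc i) r xs y)) (subsetSum-snoc f i (suc r) xs y) ⟩
    fx * (A + B * f y (suc i +ℕ r)) + (C + D * g)
      ≡⟨ ≡.cong (λ j → fx * (A + B * f y j) + (C + D * g)) (≡.sym (ℕ-+-suc i r)) ⟩
    fx * (A + B * g) + (C + D * g)         ≈⟨ +-congʳ (distribˡ _ _ _) ⟩
    (fx * A + fx * (B * g)) + (C + D * g)  ≈⟨ +-interchange _ _ _ _ ⟩
    (fx * A + C) + (fx * (B * g) + D * g)  ≈⟨ +-cong (sym (subsetSum-cons f i (suc r) x xs))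
                                                     (trans (+-congʳ (sym (*-assoc _ _ _))) (sym (distribʳ _ _ _))) ⟩
    subsetSum f i (suc (suc r)) (x ∷ xs) + (fx * B + D) * g
      ≈⟨ +-congˡ (*-congʳ (sym (subsetSum-cons f i r x xs))) ⟩
    subsetSum f i (suc (suc r)) (x ∷ xs) + subsetSum f i (suc r) (x ∷ xs) * g ∎
    where
    fx = f x i
    A = subsetSum f (suc i) (suc r) xs
    B = subsetSum f (suc i) r xs
    C = subsetSum f i (suc (suc r)) xs
    D = subsetSum f i (suc r) xs
    g = f y (i +ℕ suc r)

  subsetSum-negate : ∀ (g h : ℕ → ℕ → Carrier) → (∀ s i → - 1# * g s i ≈ h s i) →
    ∀ i r xs → negOnePow R r * subsetSum g i r xs ≈ subsetSum h i r xs
  subsetSum-negate g h neg i zero    xs       = *-identityˡ _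
  subsetSum-negate g h neg i (suc r) []       = zeroʳ _
  subsetSum-negate g h neg i (suc r) (x ∷ xs) = begin
    (- 1# * σ) * subsetSum g i (suc r) (x ∷ xs)
      ≈⟨ *-congˡ (subsetSum-cons g i r x xs) ⟩
    (- 1# * σ) * (g x i * subsetSum g (suc i) r xs + subsetSum g i (suc r) xs)
      ≈⟨ distribˡ _ _ _ ⟩
    (- 1# * σ) * (g x i * subsetSum g (suc i) r xs) + negOnePow R (suc r) * subsetSum g i (suc r) xs
      ≈⟨ +-cong (*-interchange _ _ _ _) (subsetSum-negate g h neg i (suc r) xs) ⟩
    (- 1# * g x i) * (σ * subsetSum g (suc i) r xs) + subsetSum h i (suc r) xs
      ≈⟨ +-congʳ (*-cong (neg x i) (subsetSum-negate g h neg (suc i) r xs)) ⟩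
    h x i * subsetSum h (suc i) r xs + subsetSum h i (suc r) xs
      ≈⟨ sym (subsetSum-cons h i r x xs) ⟩
    subsetSum h i (suc r) (x ∷ xs) ∎
    where σ = negOnePow R r

  factorS : (a e : ℕ → Carrier) → ℕ → ℕ → Carrier
  factorS a e s i = a (suc s ∸ i) - e s

  formula-diagonal : ∀ a e m → formulaS R a e m m ≈ 1#
  formula-diagonal a e m rewrite n∸n≡0 m = subsetSum-empty (factorS a e) 1 (oneTo m)

  formula-recurrence : ∀ a e m k → k ≤ m →
    subsetSum (factorS a e) 1 (suc (m ∸ k)) (oneTo (suc m)) ≈
      subsetSum (factorS a e) 1 (suc (m ∸ k)) (oneTo m) +
      subsetSum (factorS a e) 1 (m ∸ k) (oneTo m) * (a (suc k) - e (suc m))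
  formula-recurrence a e m k k≤m = begin
    subsetSum f 1 (suc r) (oneTo (suc m))       ≡⟨ ≡.cong (subsetSum f 1 (suc r)) (oneTo-snoc m) ⟩
    subsetSum f 1 (suc r) (oneTo m ++ suc m ∷ []) ≈⟨ subsetSum-snoc f 1 r (oneTo m) (suc m) ⟩
    subsetSum f 1 (suc r) (oneTo m) + subsetSum f 1 r (oneTo m) * (a (suc m ∸ r) - e (suc m))
      ≡⟨ ≡.cong (λ j → subsetSum f 1 (suc r) (oneTo m) + subsetSum f 1 r (oneTo m) * (a j - e (suc m)))
                (suc-∸-complement m k k≤m) ⟩
    subsetSum f 1 (suc r) (oneTo m) + subsetSum f 1 r (oneTo m) * (a (suc k) - e (suc m)) ∎
    where
    f = factorS a e
    r = m ∸ k

  connection-formula : ∀ a e S → IsConnectionMatrix R a e S →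
    ∀ m k → k ≤ m → S m k ≈ formulaS R a e m k
  connection-formula a e S conn = go
    where
    open Connection a e S conn
    G : ℕ → ℕ → Carrier
    G r m = subsetSum (factorS a e) 1 r (oneTo m)
    on-diagonal : ∀ m → S m m ≈ formulaS R a e m m
    on-diagonal m = trans (diagonal m) (sym (formula-diagonal a e m))
    go : ∀ m k → k ≤ m → S m k ≈ formulaS R a e m k
    go-below : ∀ m k → k ≤ m → below (S m) k ≈ G (suc (m ∸ k)) m
    go zero    zero z≤n = on-diagonal 0
    go (suc m) k k≤ with m≤n⇒m<n∨m≡n k≤
    ... | inj₂ ≡.refl    = on-diagonal (suc m)
    ... | inj₁ (s≤s k≤m) = begin
      S (suc m) k                                  ≈⟨ recurrence m k (m≤n⇒m≤1+n k≤m) ⟩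
      below (S m) k + (a (suc k) - e (suc m)) * S m k
        ≈⟨ +-cong (go-below m k k≤m) (trans (*-comm _ _) (*-congʳ (go m k k≤m))) ⟩
      G (suc (m ∸ k)) m + G (m ∸ k) m * (a (suc k) - e (suc m)) ≈⟨ sym (formula-recurrence a e m k k≤m) ⟩
      G (suc (m ∸ k)) (suc m)                      ≡⟨ ≡.cong (λ r → G r (suc m)) (≡.sym (+-∸-assoc 1 k≤m)) ⟩
      formulaS R a e (suc m) k                     ∎
    go-below m zero    _     = sym (subsetSum-tooMany (factorS a e) 1 m (oneTo m) (≤-reflexive (length-oneTo m)))
    go-below m (suc k) k<m = trans (go m k (<⇒≤ k<m)) (reflexive (≡.cong (λ r → G r m) (+-∸-assoc 1 k<m)))

  formula-exchange : ∀ a e m k → negOnePow R (m ∸ k) * formulaS R e a m k ≈ formulas R a e m k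
  formula-exchange a e m k =
    subsetSum-negate (factorS e a) (λ s i → a s - e (suc s ∸ i))
      (λ s i → trans (-1*x≈-x _) (⁻¹-anti-homo‿- _ _)) 1 (m ∸ k) (oneTo m)

lemma3p1 : {c ℓ : Level} (R : CommutativeRing c ℓ) →
    let open CommutativeRing R in
    (a e : ℕ → Carrier) (S s : ℕ → ℕ → Carrier) →
    IsConnectionMatrix R a e S → IsInverseOf R S s →
    (m k : ℕ) → k ≤ m →
    (S m k ≈ formulaS R a e m k) × (negOnePow R (m ∸ k) * s m k ≈ formulas R a e m k)
lemma3p1 R a e S s conn inv m k k≤m =
  connection-formula a e S conn m k k≤m ,
  trans (*-congˡ (connection-formula e a s (inverse-connection a e S s conn inv) m k k≤m))
        (formula-exchange a e m k)
  where
  open CommutativeRing R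
  open ConnectionCoefficients R
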